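{- Let $k,v$ be integers with $2\le k<v$, $2k\mid v$ and $v/k\ge 4$, and let $w=v/k$. Let $(X,\mathcal{B})$ be a simple resolvable $(v,b,r,k)$-IBD with a fixed resolution, and let $(Y,\mathcal{C})$ be a simple IBD on $Y=\{1,\dots,w\}$ with block size $w/2=v/(2k)$. Then the constructed design $(X,\mathcal{D})$ obtained from these two designs is nontrivial.
   Context: For positive integers $v,b,r,k$ with $2\le k<v$, a $(v,b,r,k)$-incomplete block design (IBD) is a pair $(X,\mathcal{B})$ where $X$ is a set of $v$ points and $\mathcal{B}$ is a multiset of $b$ subsets of $X$ (blocks), each of size $k$, such that every point lies in exactly $r$ blocks. If $k\mid v$, a parallel class is a set of $v/k$ pairwise disjoint blocks; the IBD is resolvable if $\mathcal{B}$ can be partitioned into $r$ parallel classes (a resolution). A design is simple if its multiset of blocks has no repeated block; a design on $v$ points with block size $K$ is trivial if its blocks are exactly all $\binom{v}{K}$ $K$-subsets of the point set, each once. Constructed design: given a resolvable IBD $(X,\mathcal{B})$ with block size $k$ and a resolution into parallel classes $\Pi_1,\dots,\Pi_r$, where $\Pi_i=\{B_i^1,\dots,B_i^w\}$ and $w=v/k$, and given an IBD $(Y,\mathcal{C})$ with $Y=\{1,\dots,w\}$, define for each $i$ and each block $C\in\mathcal{C}$ the set $D_{i,C}=\bigcup_{j\in C}B_i^j$, and let $\mathcal{D}$ be the multiset $\{D_{i,C}: 1\le i\le r,\ C\in\mathcal{C}\}$. The constructed design is $(X,\mathcal{D})$. -}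

module Defs where

open import Data.Nat using (ℕ; _≤_; _<_)
open import Data.Bool using (if_then_else_)
open import Data.Fin using (Fin)
open import Data.Fin.Subset using (Subset; ∣_∣; _∩_; ⋃; Empty; inside)
  renaming (⊥ to ∅)
open import Data.Vec using (lookup; tabulate)
open import Data.List using (map; allFin)
open import Data.Product using (_×_; _,_; ∃; uncurry)
open import Relation.Binary.PropositionalEquality using (_≡_; _≢_)
open import Function.Definitions using (Injective; Bijective)

record IBD (v b r k : ℕ) : Set where
  field
    two≤k     : 2 ≤ k
    k<v       : k < v
    1≤b       : 1 ≤ b
    1≤r       : 1 ≤ r
    blocks    : Fin b → Subset v
    blockSize : ∀ β → ∣ blocks β ∣ ≡ k
    -- the number of block indices β with x ∈ blocks β is r
    replication : ∀ (x : Fin v) → ∣ tabulate (λ β → lookup (blocks β) x) ∣ ≡ r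
open IBD public

Simple : ∀ {v b r k} → IBD v b r k → Set
Simple D = Injective _≡_ _≡_ (blocks D)

-- A resolution of a (v,b,r,k)-IBD, where w = v/k (i.e. v ≡ w * k):
-- the block indices are bijectively arranged as B_i^j (i : Fin r, j : Fin w)
-- and for each i the blocks B_i^1..B_i^w are pairwise disjoint
-- (so each Π_i is a parallel class, and the Π_i partition the multiset of blocks).
record Resolution {v b r k : ℕ} (D : IBD v b r k) (w : ℕ) : Set where
  field
    cls      : Fin r → Fin w → Fin b
    cls-bij  : Bijective _≡_ _≡_ (uncurry cls)
    disjoint : ∀ i j j′ → j ≢ j′ → Empty (blocks D (cls i j) ∩ blocks D (cls i j′))
open Resolution public

resBlock : ∀ {v b r k w} {D : IBD v b r k} → Resolution D w → Fin r → Fin w → Subset v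
resBlock {D = D} R i j = blocks D (cls R i j)

constructed : ∀ {v b r k w b′ r′ h} {D : IBD v b r k} → Resolution D w →
              IBD w b′ r′ h → Fin r × Fin b′ → Subset v
constructed R C (i , γ) =
  ⋃ (map (λ j → if lookup (blocks C γ) j then resBlock R i j else ∅) (allFin _))

TrivialWith : ∀ {n : ℕ} {I : Set} → ℕ → (I → Subset n) → Set
TrivialWith {n} K Dfam =
  (∀ β → ∣ Dfam β ∣ ≡ K) × Injective _≡_ _≡_ Dfam × (∀ (S : Subset n) → ∣ S ∣ ≡ K → ∃ λ β → Dfam β ≡ S)

Trivial : ∀ {n : ℕ} {I : Set} → (I → Subset n) → Set
Trivial Dfam = ∃ λ K → TrivialWith K Dfam

-- Suppose the constructed design is trivial and put u = w/2.  Its blocks D_{i,C} all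
-- have size uk, so they cover every uk-subset of the v = 2uk points:
-- choose v (uk) ≤ r b′.  Simplicity of the two ingredients gives r w = b ≤ choose v k
-- and b′ ≤ choose w u, hence w · choose (2uk) (uk) ≤ choose (2uk) k · choose (2u) u.
-- In terms of factorials this says (u+1)⋯(2u−1) · (k+1)⋯(uk) ≥ u! · (uk+1)⋯(2uk−k),
-- which fails for u, k ≥ 2: split both sides into u−1 blocks, block t comparing
-- (u+t)·(tk+1)⋯(tk+k) with (t+1)·((u+t−1)k+1)⋯((u+t)k).  The last factors have
-- ratio exactly (u+t)/(t+1) and every other factor on the right is larger.

module Submission where

open import Defs
open import Data.Nat
open import Data.Nat.Properties
open import Data.Nat.Divisibility using (_∣_; divides)
open import Data.Nat.DivMod using (_/_; m*n/n≡m)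
open import Data.Nat.Tactic.RingSolver using (solve-∀)
open import Data.Bool using (true; false; if_then_else_)
open import Data.Fin using (Fin; zero; suc; _↑ˡ_; _↑ʳ_; splitAt; combine; remQuot; fromℕ<)
import Data.Fin.Properties as Finₚ
open import Data.Fin.Properties
  using (splitAt-↑ˡ; splitAt-↑ʳ; splitAt⁻¹-↑ˡ; splitAt⁻¹-↑ʳ; injective⇒≤; combine-remQuot; remQuot-combine)
open import Data.Fin.Subset using (Subset; ∣_∣; _∩_; _∪_; ⋃; Empty; _∈_; inside; outside)
  renaming (⊥ to ∅)
open import Data.Fin.Subset.Properties using (∣⊥∣≡0; drop-∷-Empty; x∈p∩q⁻; x∈p∩q⁺; x∈p∪q⁻; ∉⊥)
open import Data.Vec using ([]; _∷_; lookup; here)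
open import Data.List using (tabulate; map; allFin)
open import Data.List.Properties using (map-tabulate)
open import Data.Product using (_,_; ∃; proj₁; proj₂; uncurry)
open import Data.Sum using (inj₁; inj₂; [_,_]′)
open import Data.Empty using (⊥; ⊥-elim)
open import Function using (_∘_; id)
open import Function.Definitions using (Injective)
open import Relation.Binary.PropositionalEquality
open import Relation.Nullary using (¬_)
open import Algebra.Properties.CommutativeSemigroup *-commutativeSemigroup
  using (interchange; x∙yz≈y∙xz; x∙yz≈y∙zx; x∙yz≈yx∙z; xy∙z≈x∙zy)

rising : ℕ → ℕ → ℕ
rising a zero    = 1
rising a (suc n) = rising a n * (a + n)

rising-+ : ∀ a n p → rising a (n + p) ≡ rising a n * rising (a + n) p
rising-+ a n zero    rewrite +-identityʳ n = sym (*-identityʳ _)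
rising-+ a n (suc p) rewrite +-suc n p | rising-+ a n p | +-assoc a n p =
  *-assoc (rising a n) _ _

rising-sucˡ : ∀ a n → rising a (suc n) ≡ a * rising (suc a) n
rising-sucˡ a zero    = trans (*-identityˡ (a + 0)) (trans (+-identityʳ a) (sym (*-identityʳ a)))
rising-sucˡ a (suc n) rewrite rising-sucˡ a n | +-suc a n =
  *-assoc a (rising (suc a) n) _

[a+n]!≡a!*rising : ∀ a n → (a + n) ! ≡ a ! * rising (suc a) n
[a+n]!≡a!*rising a zero    rewrite +-identityʳ a = sym (*-identityʳ _)
[a+n]!≡a!*rising a (suc n) rewrite +-suc a n | [a+n]!≡a!*rising a n =
  x∙yz≈y∙zx (suc (a + n)) (a !) (rising (suc a) n)

0<rising : ∀ a n → 0 < rising (suc a) n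
0<rising a zero    = z<s
0<rising a (suc n) = *-mono-< (0<rising a n) z<s

rising-monoˡ-≤ : ∀ {a b} n → a ≤ b → rising a n ≤ rising b n
rising-monoˡ-≤ zero    a≤b = ≤-refl
rising-monoˡ-≤ (suc n) a≤b = *-mono-≤ (rising-monoˡ-≤ n a≤b) (+-monoˡ-≤ n a≤b)

rising-monoˡ-< : ∀ {a b} n → a < b → rising (suc a) (suc n) < rising (suc b) (suc n)
rising-monoˡ-< {a} {b} n a<b = begin-strict
  rising (suc a) n * (suc a + n) ≤⟨ *-monoˡ-≤ (suc a + n) (rising-monoˡ-≤ n (<⇒≤ (s<s a<b))) ⟩
  rising (suc b) n * (suc a + n) <⟨ *-monoʳ-< (rising (suc b) n) {{>-nonZero (0<rising b n)}} (+-monoˡ-< n (s<s a<b)) ⟩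
  rising (suc b) n * (suc b + n) ∎
  where open ≤-Reasoning

-- Pascal's rule as the definition (rather than Data.Nat.Combinatorics._C_) makes
-- the bijection between K-subsets of Fin n and Fin (choose n K) below structural.
choose : ℕ → ℕ → ℕ
choose _       zero    = 1
choose zero    (suc k) = 0
choose (suc n) (suc k) = choose n k + choose n (suc k)

n<k⇒choose≡0 : ∀ {n k} → n < k → choose n k ≡ 0
n<k⇒choose≡0 {zero}  {suc k}       _         = refl
n<k⇒choose≡0 {suc n} {suc (suc k)} (s<s n<k) =
  cong₂ _+_ (n<k⇒choose≡0 n<k) (n<k⇒choose≡0 (m<n⇒m<1+n n<k))

0<choose : ∀ {n k} → k ≤ n → 0 < choose n k
0<choose {k = zero}      _         = z<s
0<choose {suc n} {suc k} (s≤s k≤n) = ≤-trans (0<choose k≤n) (m≤m+n _ _)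

choose[n,n]≡1 : ∀ n → choose n n ≡ 1
choose[n,n]≡1 zero    = refl
choose[n,n]≡1 (suc n) rewrite choose[n,n]≡1 n | n<k⇒choose≡0 (n<1+n n) = refl

choose[a+b,a]*a!≡rising : ∀ a b → choose (a + b) a * a ! ≡ rising (suc b) a
choose[a+b,a]*a!≡rising zero    b = refl
choose[a+b,a]*a!≡rising (suc a) zero rewrite +-identityʳ a =
  trans (cong (_* suc a !) (choose[n,n]≡1 (suc a)))
        (trans (*-identityˡ (suc a !)) (trans ([a+n]!≡a!*rising 0 (suc a)) (*-identityˡ _)))
choose[a+b,a]*a!≡rising (suc a) (suc b) = begin
  (X + Y) * (suc a * a !)                ≡⟨ *-distribʳ-+ (suc a * a !) X Y ⟩
  X * (suc a * a !) + Y * (suc a * a !)  ≡⟨ cong (_+ Y * (suc a * a !)) (x∙yz≈y∙xz X (suc a) (a !)) ⟩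
  suc a * (X * a !) + Y * (suc a * a !)  ≡⟨ cong₂ _+_ (cong (suc a *_) (choose[a+b,a]*a!≡rising a (suc b))) Y-rising ⟩
  suc a * R + suc b * R                  ≡⟨ *-distribʳ-+ R (suc a) (suc b) ⟨
  (suc a + suc b) * R                    ≡⟨ *-comm (suc a + suc b) R ⟩
  R * suc (a + suc b)                    ≡⟨ cong (λ t → R * suc t) (+-comm a (suc b)) ⟩
  R * (suc (suc b) + a)                  ∎
  where
  open ≡-Reasoning
  X = choose (a + suc b) a
  Y = choose (a + suc b) (suc a)
  R = rising (suc (suc b)) a
  Y-rising : Y * (suc a * a !) ≡ suc b * R
  Y-rising = begin
    Y * (suc a * a !)                     ≡⟨ cong (λ n → choose n (suc a) * (suc a * a !)) (+-suc a b) ⟩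
    choose (suc a + b) (suc a) * suc a !  ≡⟨ choose[a+b,a]*a!≡rising (suc a) b ⟩
    rising (suc b) (suc a)                ≡⟨ rising-sucˡ (suc b) a ⟩
    suc b * R                             ∎

choose-shift : ∀ k d e →
  choose (k + d + e) (k + d) * rising (suc k) d ≡ choose (k + d + e) k * rising (suc e) d
choose-shift k d e = *-cancelʳ-≡ _ _ (k !) {{k !≢0}} (begin
  choose N (k + d) * rising (suc k) d * k !
    ≡⟨ xy∙z≈x∙zy (choose N (k + d)) (rising (suc k) d) (k !) ⟩
  choose N (k + d) * (k ! * rising (suc k) d)
    ≡⟨ cong (choose N (k + d) *_) ([a+n]!≡a!*rising k d) ⟨
  choose N (k + d) * (k + d) !
    ≡⟨ choose[a+b,a]*a!≡rising (k + d) e ⟩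
  rising (suc e) (k + d)
    ≡⟨ cong (rising (suc e)) (+-comm k d) ⟩
  rising (suc e) (d + k)
    ≡⟨ rising-+ (suc e) d k ⟩
  rising (suc e) d * rising (suc (e + d)) k
    ≡⟨ cong (λ t → rising (suc e) d * rising (suc t) k) (+-comm e d) ⟩
  rising (suc e) d * rising (suc (d + e)) k
    ≡⟨ cong (rising (suc e) d *_) (choose[a+b,a]*a!≡rising k (d + e)) ⟨
  rising (suc e) d * (choose (k + (d + e)) k * k !)
    ≡⟨ cong (λ n → rising (suc e) d * (choose n k * k !)) (+-assoc k d e) ⟨
  rising (suc e) d * (choose N k * k !)
    ≡⟨ x∙yz≈yx∙z (rising (suc e) d) (choose N k) (k !) ⟩
  choose N k * rising (suc e) d * k ! ∎)
  where
  open ≡-Reasoning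
  N = k + d + e

choose[2n,n]*n!≡2n*rising : ∀ n →
  choose (suc n + suc n) (suc n) * suc n ! ≡ (suc n + suc n) * rising (suc (suc n)) n
choose[2n,n]*n!≡2n*rising n = begin
  choose (suc n + suc n) (suc n) * suc n !        ≡⟨ choose[a+b,a]*a!≡rising (suc n) (suc n) ⟩
  rising (suc (suc n)) n * (suc (suc n) + n)      ≡⟨ *-comm (rising (suc (suc n)) n) _ ⟩
  (suc (suc n) + n) * rising (suc (suc n)) n      ≡⟨ cong (λ t → suc t * rising (suc (suc n)) n) (+-suc n n) ⟨
  (suc n + suc n) * rising (suc (suc n)) n        ∎
  where open ≡-Reasoning

-- The last factors (s+2)k and (u+s+1)k cancel the multipliers exactly:
-- (u+1+s)·(s+2)k = (s+2)·(u+s+1)k.  The other k−1 factors grow because u ≥ 2.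
rising-block-< : ∀ {u k} → 1 < u → 1 < k → ∀ s →
  (suc u + s) * rising (suc k + s * k) k < suc (suc s) * rising (suc (u * k) + s * k) k
rising-block-< {u} {suc k′@(suc k″)} 1<u (s<s (s<s z≤n)) s = begin-strict
  (suc u + s) * (rising c k′ * (c + k′))     ≡⟨ x∙yz≈y∙xz (suc u + s) (rising c k′) (c + k′) ⟩
  rising c k′ * ((suc u + s) * (c + k′))     ≡⟨ cong (rising c k′ *_) (last-factors u s k′) ⟩
  rising c k′ * (suc (suc s) * (d + k′))     <⟨ *-monoˡ-< (suc (suc s) * (d + k′)) (rising-monoˡ-< k″ c<d) ⟩
  rising d k′ * (suc (suc s) * (d + k′))     ≡⟨ x∙yz≈y∙xz (rising d k′) (suc (suc s)) (d + k′) ⟩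
  suc (suc s) * (rising d k′ * (d + k′))     ∎
  where
  open ≤-Reasoning
  c = suc (suc k′) + s * suc k′
  d = suc (u * suc k′) + s * suc k′
  last-factors : ∀ u s k′ → (suc u + s) * (suc (suc k′) + s * suc k′ + k′)
                              ≡ suc (suc s) * (suc (u * suc k′) + s * suc k′ + k′)
  last-factors = solve-∀
  c<d : suc k′ + s * suc k′ < u * suc k′ + s * suc k′
  c<d = +-monoˡ-< (s * suc k′) (subst (_< u * suc k′) (*-identityˡ _) (*-monoˡ-< (suc k′) 1<u))

rising-suc-* : ∀ a s k → rising a (suc s * k) ≡ rising a (s * k) * rising (a + s * k) k
rising-suc-* a s k = trans (cong (rising a) (+-comm k (s * k))) (rising-+ a (s * k) k)

rising-blocks-suc-< : ∀ {u k} → 1 < u → 1 < k → ∀ s →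
  rising (suc u) s * rising (suc k) (s * k) ≤ suc s ! * rising (suc (u * k)) (s * k) →
  rising (suc u) (suc s) * rising (suc k) (suc s * k) < suc (suc s) ! * rising (suc (u * k)) (suc s * k)
rising-blocks-suc-< {u} {k} 1<u 1<k s IH = begin-strict
  rising (suc u) s * (suc u + s) * rising (suc k) (suc s * k)
    ≡⟨ cong (rising (suc u) s * (suc u + s) *_) (rising-suc-* (suc k) s k) ⟩
  rising (suc u) s * (suc u + s) * (rising (suc k) (s * k) * rising (suc k + s * k) k)
    ≡⟨ interchange (rising (suc u) s) (suc u + s) (rising (suc k) (s * k)) _ ⟩
  rising (suc u) s * rising (suc k) (s * k) * ((suc u + s) * rising (suc k + s * k) k)
    ≤⟨ *-monoˡ-≤ _ IH ⟩
  suc s ! * R * ((suc u + s) * rising (suc k + s * k) k)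
    <⟨ *-monoʳ-< (suc s ! * R) {{m*n≢0 (suc s !) R {{suc s !≢0}} {{>-nonZero (0<rising (u * k) (s * k))}}}}
                 (rising-block-< 1<u 1<k s) ⟩
  suc s ! * R * (suc (suc s) * rising (suc (u * k) + s * k) k)
    ≡⟨ interchange (suc s !) R (suc (suc s)) _ ⟩
  suc s ! * suc (suc s) * (R * rising (suc (u * k) + s * k) k)
    ≡⟨ cong₂ _*_ (*-comm (suc s !) (suc (suc s))) (sym (rising-suc-* (suc (u * k)) s k)) ⟩
  suc (suc s) ! * rising (suc (u * k)) (suc s * k) ∎
  where
  open ≤-Reasoning
  R = rising (suc (u * k)) (s * k)

rising-blocks-≤ : ∀ {u k} → 1 < u → 1 < k → ∀ s →
  rising (suc u) s * rising (suc k) (s * k) ≤ suc s ! * rising (suc (u * k)) (s * k)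
rising-blocks-≤ 1<u 1<k zero    = ≤-refl
rising-blocks-≤ 1<u 1<k (suc s) = <⇒≤ (rising-blocks-suc-< 1<u 1<k s (rising-blocks-≤ 1<u 1<k s))

choose[2m,k]*choose[2u,u]<2u*choose[2m,m] : ∀ {u k} → 1 < u → 1 < k →
  choose (u * k + u * k) k * choose (u + u) u < (u + u) * choose (u * k + u * k) (u * k)
choose[2m,k]*choose[2u,u]<2u*choose[2m,m] {suc (suc s)} {k} 1<u@(s<s (s<s z≤n)) 1<k =
  *-cancelʳ-< (u ! * Rs) (X * Y) (w * Z) (begin-strict
    X * Y * (u ! * Rs)       ≡⟨ *-assoc X Y (u ! * Rs) ⟩
    X * (Y * (u ! * Rs))     ≡⟨ cong (X *_) (*-assoc Y (u !) Rs) ⟨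
    X * (Y * u ! * Rs)       ≡⟨ cong (λ t → X * (t * Rs)) (choose[2n,n]*n!≡2n*rising (suc s)) ⟩
    X * (w * b * Rs)         ≡⟨ cong (X *_) (*-assoc w b Rs) ⟩
    X * (w * (b * Rs))       ≡⟨ x∙yz≈yx∙z X w (b * Rs) ⟩
    w * X * (b * Rs)         <⟨ *-monoʳ-< (w * X) {{m*n≢0 w X {{_}} {{>-nonZero 0<X}}}}
                                 (rising-blocks-suc-< 1<u 1<k s (rising-blocks-≤ 1<u 1<k s)) ⟩
    w * X * (u ! * Rb)       ≡⟨ interchange w X (u !) Rb ⟩
    w * u ! * (X * Rb)       ≡⟨ cong (w * u ! *_) (choose-shift k d m) ⟨
    w * u ! * (Z * Rs)       ≡⟨ interchange w (u !) Z Rs ⟩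
    w * Z * (u ! * Rs)       ∎)
  where
  open ≤-Reasoning
  u = suc (suc s)
  d = suc s * k
  m = u * k
  w = u + u
  X = choose (m + m) k
  Y = choose w u
  Z = choose (m + m) m
  b = rising (suc u) (suc s)
  Rs = rising (suc k) d
  Rb = rising (suc m) d
  0<X : 0 < X
  0<X = 0<choose (≤-trans (m≤m+n k d) (m≤m+n m m))

∣p∣≡0⇒p≡∅ : ∀ {n} (p : Subset n) → ∣ p ∣ ≡ 0 → p ≡ ∅
∣p∣≡0⇒p≡∅ []            _  = refl
∣p∣≡0⇒p≡∅ (outside ∷ p) eq = cong (outside ∷_) (∣p∣≡0⇒p≡∅ p eq)

toFin : ∀ {n K} (S : Subset n) → .(∣ S ∣ ≡ K) → Fin (choose n K)
toFin {K = zero}        _             _ = zero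
toFin {zero}  {suc K}   []            ()
toFin {suc n} {suc K}   (inside ∷ S)  p = toFin S (suc-injective p) ↑ˡ choose n (suc K)
toFin {suc n} {suc K}   (outside ∷ S) p = choose n K ↑ʳ toFin S p

fromFin : ∀ {n} K → Fin (choose n K) → Subset n
fromFin zero            _ = ∅
fromFin {suc n} (suc K) i =
  [ (inside ∷_) ∘ fromFin K , (outside ∷_) ∘ fromFin (suc K) ]′ (splitAt (choose n K) i)

fromFin-size : ∀ {n} K (i : Fin (choose n K)) → ∣ fromFin K i ∣ ≡ K
fromFin-size {n} zero       _ = ∣⊥∣≡0 n
fromFin-size {suc n} (suc K) i with splitAt (choose n K) i
... | inj₁ j = cong suc (fromFin-size {n} K j)
... | inj₂ j = fromFin-size {n} (suc K) j

toFin-fromFin : ∀ {n} K (i : Fin (choose n K)) → toFin (fromFin K i) (fromFin-size K i) ≡ i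
toFin-fromFin zero            zero = refl
toFin-fromFin {suc n} (suc K) i with splitAt (choose n K) i in eq
... | inj₁ j = trans (cong (_↑ˡ choose n (suc K)) (toFin-fromFin {n} K j)) (splitAt⁻¹-↑ˡ eq)
... | inj₂ j = trans (cong (choose n K ↑ʳ_) (toFin-fromFin {n} (suc K) j)) (splitAt⁻¹-↑ʳ eq)

fromFin-toFin : ∀ {n K} (S : Subset n) (p : ∣ S ∣ ≡ K) → fromFin K (toFin S p) ≡ S
fromFin-toFin {K = zero}      S             p = sym (∣p∣≡0⇒p≡∅ S p)
fromFin-toFin {suc n} {suc K} (inside ∷ S)  p =
  trans (cong [ _ , _ ]′ (splitAt-↑ˡ (choose n K) (toFin S (suc-injective p)) _))
        (cong (inside ∷_) (fromFin-toFin S (suc-injective p)))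
fromFin-toFin {suc n} {suc K} (outside ∷ S) p =
  trans (cong [ _ , _ ]′ (splitAt-↑ʳ (choose n K) _ (toFin S p)))
        (cong (outside ∷_) (fromFin-toFin S p))

toFin-cong : ∀ {n K} {S S′ : Subset n} .{p : ∣ S ∣ ≡ K} .{p′ : ∣ S′ ∣ ≡ K} →
             S ≡ S′ → toFin S p ≡ toFin S′ p′
toFin-cong refl = refl

fromFin-injective : ∀ {n} K → Injective _≡_ _≡_ (fromFin {n} K)
fromFin-injective K {i} {j} eq =
  trans (sym (toFin-fromFin K i)) (trans (toFin-cong {K = K} eq) (toFin-fromFin K j))

injective⇒≤choose : ∀ {n c K} (F : Fin c → Subset n) → (∀ i → ∣ F i ∣ ≡ K) →
                    Injective _≡_ _≡_ F → c ≤ choose n K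
injective⇒≤choose {K = K} F size F-inj =
  injective⇒≤ {f = λ i → toFin (F i) (size i)} λ {i} {j} eq →
    F-inj (trans (sym (fromFin-toFin (F i) (size i)))
                 (trans (cong (fromFin K) eq) (fromFin-toFin (F j) (size j))))

covering⇒choose≤ : ∀ {n c K} (F : Fin c → Subset n) → (∀ S → ∣ S ∣ ≡ K → ∃ λ i → F i ≡ S) →
                   choose n K ≤ c
covering⇒choose≤ {K = K} F cover = injective⇒≤ {f = preimage} λ {i} {j} eq →
  fromFin-injective K (trans (sym (F∘preimage i)) (trans (cong F eq) (F∘preimage j)))
  where
  preimage : Fin (choose _ K) → Fin _
  preimage i = proj₁ (cover (fromFin K i) (fromFin-size K i))
  F∘preimage : ∀ i → F (preimage i) ≡ fromFin K i
  F∘preimage i = proj₂ (cover (fromFin K i) (fromFin-size K i))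

PairwiseDisjoint : ∀ {n w} → (Fin w → Subset n) → Set
PairwiseDisjoint B = ∀ j j′ → j ≢ j′ → Empty (B j ∩ B j′)

∣p∪q∣≡∣p∣+∣q∣ : ∀ {n} (p q : Subset n) → Empty (p ∩ q) → ∣ p ∪ q ∣ ≡ ∣ p ∣ + ∣ q ∣
∣p∪q∣≡∣p∣+∣q∣ []            []            _ = refl
∣p∪q∣≡∣p∣+∣q∣ (inside ∷ p)  (inside ∷ q)  e = ⊥-elim (e (zero , here))
∣p∪q∣≡∣p∣+∣q∣ (inside ∷ p)  (outside ∷ q) e = cong suc (∣p∪q∣≡∣p∣+∣q∣ p q (drop-∷-Empty e))
∣p∪q∣≡∣p∣+∣q∣ (outside ∷ p) (inside ∷ q)  e =
  trans (cong suc (∣p∪q∣≡∣p∣+∣q∣ p q (drop-∷-Empty e))) (sym (+-suc ∣ p ∣ ∣ q ∣))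
∣p∪q∣≡∣p∣+∣q∣ (outside ∷ p) (outside ∷ q) e = ∣p∪q∣≡∣p∣+∣q∣ p q (drop-∷-Empty e)

x∈⋃⁻ : ∀ {n w} (G : Fin w → Subset n) {x} → x ∈ ⋃ (tabulate G) → ∃ λ j → x ∈ G j
x∈⋃⁻ {w = zero}  G x∈ = ⊥-elim (∉⊥ x∈)
x∈⋃⁻ {w = suc w} G x∈ with x∈p∪q⁻ (G zero) (⋃ (tabulate (G ∘ suc))) x∈
... | inj₁ x∈G0 = zero , x∈G0
... | inj₂ x∈⋃G = let j , x∈Gj = x∈⋃⁻ (G ∘ suc) x∈⋃G in suc j , x∈Gj

select : ∀ {n w} → Subset w → (Fin w → Subset n) → Fin w → Subset n
select c B j = if lookup c j then B j else ∅

select⊆ : ∀ {n w} (c : Subset w) (B : Fin w → Subset n) j {x} → x ∈ select c B j → x ∈ B j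
select⊆ c B j x∈ with lookup c j
... | true  = x∈
... | false = ⊥-elim (∉⊥ x∈)

∣⋃select∣ : ∀ {n w k} (c : Subset w) (B : Fin w → Subset n) → PairwiseDisjoint B →
            (∀ j → ∣ B j ∣ ≡ k) → ∣ ⋃ (tabulate (select c B)) ∣ ≡ ∣ c ∣ * k
∣⋃select∣ {n}         []      B _        _    = ∣⊥∣≡0 n
∣⋃select∣ {n} {k = k} (s ∷ c) B disjoint size = begin
  ∣ select (s ∷ c) B zero ∪ ⋃ (tabulate (select c (B ∘ suc))) ∣
    ≡⟨ ∣p∪q∣≡∣p∣+∣q∣ (select (s ∷ c) B zero) _ head-rest-disjoint ⟩
  ∣ select (s ∷ c) B zero ∣ + ∣ ⋃ (tabulate (select c (B ∘ suc))) ∣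
    ≡⟨ cong (∣ select (s ∷ c) B zero ∣ +_) (∣⋃select∣ c (B ∘ suc) rest-disjoint (size ∘ suc)) ⟩
  ∣ select (s ∷ c) B zero ∣ + ∣ c ∣ * k
    ≡⟨ head-size s ⟩
  ∣ s ∷ c ∣ * k ∎
  where
  open ≡-Reasoning
  rest-disjoint : PairwiseDisjoint (B ∘ suc)
  rest-disjoint j j′ j≢j′ = disjoint (suc j) (suc j′) (j≢j′ ∘ Finₚ.suc-injective)
  head-size : ∀ s → ∣ (if s then B zero else ∅) ∣ + ∣ c ∣ * k ≡ ∣ s ∷ c ∣ * k
  head-size true  = cong (_+ ∣ c ∣ * k) (size zero)
  head-size false = cong (_+ ∣ c ∣ * k) (∣⊥∣≡0 n)
  head-rest-disjoint : Empty (select (s ∷ c) B zero ∩ ⋃ (tabulate (select c (B ∘ suc))))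
  head-rest-disjoint (x , x∈∩) with x∈p∩q⁻ (select (s ∷ c) B zero) _ x∈∩
  ... | x∈head , x∈rest with x∈⋃⁻ (select c (B ∘ suc)) x∈rest
  ...   | j , x∈Bj = disjoint zero (suc j) (λ ())
                       (x , x∈p∩q⁺ (select⊆ (s ∷ c) B zero x∈head , select⊆ c (B ∘ suc) j x∈Bj))

constructed-size : ∀ {v b r k w b′ r′ h} {B : IBD v b r k} (R : Resolution B w) (C : IBD w b′ r′ h) i γ →
                   ∣ constructed R C (i , γ) ∣ ≡ h * k
constructed-size {k = k} {h = h} {B = B} R C i γ = begin
  ∣ ⋃ (map (select c (resBlock R i)) (allFin _)) ∣
    ≡⟨ cong (∣_∣ ∘ ⋃) (map-tabulate id (select c (resBlock R i))) ⟩
  ∣ ⋃ (tabulate (select c (resBlock R i))) ∣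
    ≡⟨ ∣⋃select∣ c (resBlock R i) (disjoint R i) (λ j → blockSize B (cls R i j)) ⟩
  ∣ c ∣ * k
    ≡⟨ cong (_* k) (blockSize C γ) ⟩
  h * k ∎
  where
  open ≡-Reasoning
  c = blocks C γ

trivial⇒choose-bound : ∀ {v b r k w b′ r′ h} {B : IBD v b r k} → Simple B → (R : Resolution B w) →
  (C : IBD w b′ r′ h) → Simple C → Trivial (constructed R C) → w * choose v (h * k) ≤ choose v k * choose w h
trivial⇒choose-bound {v} {r = r} {k} {w} {b′} {h = h} {B} B-simple R C C-simple (K , size , _ , cover) = begin
  w * choose v (h * k)   ≤⟨ *-monoʳ-≤ w blocks≥ ⟩
  w * (r * b′)           ≡⟨ x∙yz≈yx∙z w r b′ ⟩
  r * w * b′             ≤⟨ *-mono-≤ classes≤ C-blocks≤ ⟩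
  choose v k * choose w h ∎
  where
  open ≤-Reasoning
  K≡h*k : K ≡ h * k
  K≡h*k = trans (sym (size (fromℕ< (1≤r B) , fromℕ< (1≤b C)))) (constructed-size R C _ _)
  classes≤ : r * w ≤ choose v k
  classes≤ =
    injective⇒≤choose (blocks B ∘ uncurry (cls R) ∘ remQuot w) (λ _ → blockSize B _) λ {x} {y} eq →
      trans (sym (combine-remQuot {r} w x))
            (trans (cong (uncurry combine) (proj₁ (cls-bij R) (B-simple eq))) (combine-remQuot {r} w y))
  C-blocks≤ : b′ ≤ choose w h
  C-blocks≤ = injective⇒≤choose (blocks C) (blockSize C) C-simple
  blocks≥ : choose v (h * k) ≤ r * b′
  blocks≥ = covering⇒choose≤ (constructed R C ∘ remQuot b′) λ S ∣S∣≡hk →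
    let (i , γ) , D≡S = cover S (trans ∣S∣≡hk (sym K≡h*k))
    in combine i γ , trans (cong (constructed R C) (remQuot-combine i γ)) D≡S

theorem3p1 : ∀ (v k w b r b′ r′ : ℕ) → 2 ≤ k → k < v → 2 * k ∣ v → v ≡ w * k → 4 ≤ w →
    (B : IBD v b r k) → Simple B → (R : Resolution B w) →
    (C : IBD w b′ r′ (w / 2)) → Simple C →
    ¬ Trivial (constructed R C)
theorem3p1 v k w b r b′ r′ 2≤k _ (divides q v≡q*[2k]) v≡w*k 4≤w B B-simple R C C-simple trivial =
  impossible v≡2qk w≡2q w/2≡q (trivial⇒choose-bound B-simple R C C-simple trivial)
  where
  instance
    _ : NonZero k
    _ = >-nonZero (<-trans z<s 2≤k)
  w≡q*2 : w ≡ q * 2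
  w≡q*2 = *-cancelʳ-≡ w (q * 2) k (trans (sym v≡w*k) (trans v≡q*[2k] (sym (*-assoc q 2 k))))
  w≡2q : w ≡ q + q
  w≡2q = trans w≡q*2 (trans (*-comm q 2) (cong (q +_) (+-identityʳ q)))
  w/2≡q : w / 2 ≡ q
  w/2≡q = trans (cong (_/ 2) w≡q*2) (m*n/n≡m q 2)
  v≡2qk : v ≡ q * k + q * k
  v≡2qk = trans v≡w*k (trans (cong (_* k) w≡2q) (*-distribʳ-+ k q q))
  1<q : 1 < q
  1<q = *-cancelʳ-≤ 2 q 2 (subst (4 ≤_) w≡q*2 4≤w)
  impossible : ∀ {v w h} → v ≡ q * k + q * k → w ≡ q + q → h ≡ q →
               w * choose v (h * k) ≤ choose v k * choose w h → ⊥
  impossible refl refl refl = <⇒≱ (choose[2m,k]*choose[2u,u]<2u*choose[2m,m] 1<q 2≤k)
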